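{- Let $\ell\ge2$ and let $(b|g;f_1,\dots,f_\ell)=(d_{n,k})_{n,k\ge0}$ be a multiple almost-Riordan array with $b(t)=\sum_{k\ge0}b_{\ell k}t^{\ell k}$, $g(t)=\sum_{k\ge0}g_{\ell k}t^{\ell k}$, $f_j(t)=\sum_{k\ge0}f_{j,\ell k+1}t^{\ell k+1}$ ($j=1,\dots,\ell$). Define its compression $(\hat d_{n,k})_{n\ge k\ge0}$ by $\hat d_{n,k}=d_{\ell n-(\ell-1)k,\,k}$, and set $$\hat b(t)=\sum_{k\ge0}b_{\ell k}t^k,\quad \hat g(t)=\sum_{k\ge0}g_{\ell k}t^k,\quad \hat f_j(t)=\sum_{k\ge0}f_{j,\ell k+1}t^{k+1}\ (j=1,\dots,\ell).$$ Then $\hat d_{n,0}=[t^n]\hat b(t)$, and for $k\ge1$: $$\hat d_{n,k}=[t^n]\,t\,\hat g\,(\hat f_1\hat f_2\cdots\hat f_\ell)^{(k-1)/\ell}\quad\text{if }k\equiv1\pmod\ell,$$ $$\hat d_{n,k}=[t^n]\,t\,\hat g\,\hat f_1\hat f_2\cdots\hat f_{m-1}(\hat f_1\hat f_2\cdots\hat f_\ell)^{(k-m)/\ell}\quad\text{if }k\equiv m\pmod\ell,\ m\in\{2,\dots,\ell\}.$$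
   Context: Fix an integer $\ell\ge2$ and a field $\mathbb K$ of characteristic $0$; $\mathbb K[[t^\ell]]$ denotes the formal power series in $t^\ell$. For $b,g\in\mathbb K[[t^\ell]]$ with $b(0)\ne0$, $g(0)\ne0$ and $f_1,\dots,f_\ell\in t\mathbb K[[t^\ell]]$ with nonzero coefficient of $t$, the multiple almost-Riordan array $(b|g;f_1,\dots,f_\ell)$ is the infinite lower triangular matrix $(d_{n,k})_{n,k\ge0}$ with $d_{n,0}=[t^n]b(t)$ and, for $k\ge1$, $d_{n,k}=[t^n]\,t\,g\,f_1^{e_1(k)}\cdots f_\ell^{e_\ell(k)}$ with $e_i(k)=\lfloor (k-1+\ell-i)/\ell\rfloor$ (columns $b, tg, tgf_1, tgf_1f_2,\dots,tgf_1\cdots f_\ell, tgf_1^2f_2\cdots f_\ell,\dots$). In the case $m=\ell$, "$k\equiv m\pmod\ell$" means $k\equiv0\pmod\ell$. -}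

module Defs where

open import Level using (Level; _⊔_)
open import Algebra.Bundles using (CommutativeRing)
open import Data.Nat as ℕ using (ℕ; zero; suc; _∸_; _%_; _/_; NonZero; _≤_)
open import Data.Nat.Divisibility using (_∣_)
open import Data.Fin using (Fin; toℕ)
import Data.Fin as Fin
open import Data.Product using (Σ; _×_)
open import Relation.Nullary using (¬_)

module Series {c r : Level} (R : CommutativeRing c r) where
  open CommutativeRing R

  -- formal power series over R, as coefficient sequences: f n = [t^n] f
  PS : Set c
  PS = ℕ → Carrier

  sumTo : ℕ → (ℕ → Carrier) → Carrier
  sumTo zero    a = 0#
  sumTo (suc n) a = sumTo n a + a n

  _⊛_ : PS → PS → PS
  (f ⊛ g) n = sumTo (suc n) (λ i → f i * g (n ∸ i))

  one : PS
  one zero    = 1#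
  one (suc n) = 0#

  tmul : PS → PS
  tmul f zero    = 0#
  tmul f (suc n) = f n

  _^ₚ_ : PS → ℕ → PS
  f ^ₚ zero  = one
  f ^ₚ suc k = (f ^ₚ k) ⊛ f

  prodFin : (m : ℕ) → (Fin m → PS) → PS
  prodFin zero    F = one
  prodFin (suc m) F = F Fin.zero ⊛ prodFin m (λ i → F (Fin.suc i))

  prodFirst : (m : ℕ) → (Fin m → PS) → ℕ → PS
  prodFirst zero    F j       = one
  prodFirst (suc m) F zero    = one
  prodFirst (suc m) F (suc j) = F Fin.zero ⊛ prodFirst m (λ i → F (Fin.suc i)) j

  IsField : Set (c ⊔ r)
  IsField = (¬ (1# ≈ 0#)) × (∀ x → ¬ (x ≈ 0#) → Σ Carrier (λ y → x * y ≈ 1#))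

  natK : ℕ → Carrier
  natK zero    = 0#
  natK (suc n) = 1# + natK n

  CharZero : Set r
  CharZero = ∀ n → ¬ (natK (suc n) ≈ 0#)

  InPowT^ : ℕ → PS → Set r
  InPowT^ L f = ∀ n → ¬ (L ∣ n) → f n ≈ 0#

  -- f ∈ t K[[t^L]]  (only exponents n with L ∣ n ∸ 1 and n ≥ 1)
  InTPowT^ : ℕ → PS → Set r
  InTPowT^ L f = (f 0 ≈ 0#) × (∀ n → ¬ (L ∣ n) → f (suc n) ≈ 0#)

  -- The multiple almost-Riordan array (b | g ; f_1, ..., f_L), where
  -- f (i) for i : Fin L stands for f_{toℕ i + 1}, and
  -- e_i(k) = ⌊(k - 1 + L - i)/L⌋ for i = toℕ j + 1.
  module _ (L : ℕ) .{{_ : NonZero L}} where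
    expo : Fin L → ℕ → ℕ
    expo j k = (k ∸ 1 ℕ.+ L ∸ suc (toℕ j)) / L

    mar : PS → PS → (Fin L → PS) → ℕ → ℕ → Carrier
    mar b g f n zero    = b n
    mar b g f n (suc k) =
      tmul (g ⊛ prodFin L (λ j → f j ^ₚ expo j (suc k))) n

    compress : (ℕ → ℕ → Carrier) → ℕ → ℕ → Carrier
    compress d n k = d (L ℕ.* n ∸ (L ∸ 1) ℕ.* k) k

    hatEven : PS → PS
    hatEven b k = b (L ℕ.* k)

    hatOdd : PS → PS
    hatOdd f zero    = 0#
    hatOdd f (suc k) = f (L ℕ.* k ℕ.+ 1)

≥2⇒nonZero : {L : ℕ} → 2 ≤ L → NonZero L
≥2⇒nonZero (ℕ.s≤s _) = _

-- Write k = 1 + m + qL with m < L. Then e_i(k) = q + [i ≤ m], so column k of the array is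
-- t g f₁⋯f_m (f₁⋯f_L)^q. Since g = ĝ(t^L) and f_j = t φ_j(t^L) with f̂_j = t φ_j, and the
-- substitution t ↦ t^L is multiplicative, this column equals t^k X(t^L) for
-- X = ĝ φ₁⋯φ_m (φ₁⋯φ_L)^q, while the claimed column of the compression is t^k X(t). Row Ln − (L−1)k = k + L(n − k) of the former and row n of the latter both carry the
-- coefficient [t^(n−k)] X.

module Submission where

open import Defs
open import Level using (Level)
open import Algebra.Bundles using (CommutativeRing)
open import Data.Nat using (ℕ; zero; suc; _∸_; _%_; _/_; _≤_)
open import Data.Fin using (Fin)
open import Data.Product using (_×_)
open import Relation.Nullary using (¬_)
open import Relation.Binary.PropositionalEquality using (_≡_)

open import Algebra.Bundles using (CommutativeMonoid)
import Algebra.Properties.CommutativeSemigroup as CommutativeSemigroupProperties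
open import Data.Nat using (_+_; _*_; _<_; _<?_; z≤n; s≤s; NonZero; >-nonZero; >-nonZero⁻¹)
open import Data.Nat.DivMod
  using ( /-congˡ; +-distrib-/-∣ʳ; m<n⇒m/n≡0; n/n≡1; m*n/n≡m; m/n*n≡m
        ; m≡m%n+[m/n]*n; m<n⇒m%n≡m; m%n≤m; n%n≡0 )
open import Data.Nat.Tactic.RingSolver using (solve-∀)
import Data.Nat.Properties as ℕ
open import Data.Nat.Divisibility
  using (_∣_; _∣?_; divides; _∣0; ∣-refl; ∣⇒≤; n∣m*n; m%n≡0⇒n∣m; ∣m+n∣m⇒∣n; ∣m∣n⇒∣m+n)
open import Data.Fin as Fin using (toℕ)
open import Data.Fin.Properties using (toℕ<n)
open import Data.Product using (_,_; proj₂)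
open import Function using (_∘_)
open import Relation.Binary.Bundles using (Setoid)
open import Relation.Binary.Structures using (IsEquivalence)
import Relation.Binary.PropositionalEquality as ≡
import Relation.Binary.Reasoning.Setoid as SetoidReasoning
open import Relation.Nullary using (yes; no)
open import Data.Empty using (⊥-elim)

module ℕ+ = CommutativeSemigroupProperties ℕ.+-commutativeSemigroup

[_<_] : ℕ → ℕ → ℕ
[ _     < zero  ] = 0
[ zero  < suc m ] = 1
[ suc j < suc m ] = [ j < m ]

[<]≡1 : ∀ {j m} → j < m → [ j < m ] ≡ 1
[<]≡1 {zero}  {suc m} _         = ≡.refl
[<]≡1 {suc j} {suc m} (s≤s j<m) = [<]≡1 j<m

[≥]≡0 : ∀ {j m} → m ≤ j → [ j < m ] ≡ 0
[≥]≡0 {j}     {zero}  _         = ≡.refl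
[≥]≡0 {suc j} {suc m} (s≤s m≤j) = [≥]≡0 m≤j

module _ (L : ℕ) .{{_ : NonZero L}} where
  open ≡.≡-Reasoning

  [m+L∸1+j]/L≡[j<m] : ∀ {j m} → j < L → m < L → (m + (L ∸ suc j)) / L ≡ [ j < m ]
  [m+L∸1+j]/L≡[j<m] {j} {m} j<L m<L with j <? m
  ... | yes j<m = begin
    (m + (L ∸ suc j)) / L                 ≡⟨ /-congˡ m+L∸1+j≡[m∸1+j]+L ⟩
    ((m ∸ suc j) + L) / L                 ≡⟨ +-distrib-/-∣ʳ (m ∸ suc j) ∣-refl ⟩
    (m ∸ suc j) / L + L / L               ≡⟨ ≡.cong₂ _+_ (m<n⇒m/n≡0 m∸1+j<L) (n/n≡1 L) ⟩
    1                                     ≡⟨ [<]≡1 j<m ⟨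
    [ j < m ]                             ∎
    where
      m∸1+j<L : m ∸ suc j < L
      m∸1+j<L = ℕ.≤-<-trans (ℕ.m∸n≤m m (suc j)) m<L
      m+L∸1+j≡[m∸1+j]+L : m + (L ∸ suc j) ≡ (m ∸ suc j) + L
      m+L∸1+j≡[m∸1+j]+L = begin
        m + (L ∸ suc j)                   ≡⟨ ≡.cong (_+ (L ∸ suc j)) (ℕ.m∸n+n≡m j<m) ⟨
        (m ∸ suc j) + suc j + (L ∸ suc j) ≡⟨ ℕ.+-assoc (m ∸ suc j) (suc j) (L ∸ suc j) ⟩
        (m ∸ suc j) + (suc j + (L ∸ suc j)) ≡⟨ ≡.cong ((m ∸ suc j) +_) (ℕ.m+[n∸m]≡n j<L) ⟩
        (m ∸ suc j) + L                   ∎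
  ... | no j≮m = ≡.trans (m<n⇒m/n≡0 m+L∸1+j<L) (≡.sym ([≥]≡0 (ℕ.≮⇒≥ j≮m)))
    where
      m+L∸1+j<L : m + (L ∸ suc j) < L
      m+L∸1+j<L = ≡.subst (m + (L ∸ suc j) <_) (ℕ.m+[n∸m]≡n j<L)
        (ℕ.+-monoˡ-< (L ∸ suc j) (s≤s (ℕ.≮⇒≥ j≮m)))

  [m+qL+L∸1+j]/L≡[j<m]+q : ∀ {j m} q → j < L → m < L →
                            (m + q * L + L ∸ suc j) / L ≡ [ j < m ] + q
  [m+qL+L∸1+j]/L≡[j<m]+q {j} {m} q j<L m<L = begin
    (m + q * L + L ∸ suc j) / L           ≡⟨ /-congˡ (ℕ.+-∸-assoc (m + q * L) j<L) ⟩
    (m + q * L + (L ∸ suc j)) / L         ≡⟨ /-congˡ (ℕ+.xy∙z≈xz∙y m (q * L) (L ∸ suc j)) ⟩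
    (m + (L ∸ suc j) + q * L) / L         ≡⟨ +-distrib-/-∣ʳ (m + (L ∸ suc j)) (n∣m*n q) ⟩
    (m + (L ∸ suc j)) / L + q * L / L     ≡⟨ ≡.cong₂ _+_ ([m+L∸1+j]/L≡[j<m] j<L m<L) (m*n/n≡m q L) ⟩
    [ j < m ] + q                         ∎

  %≡%⇒k≡m+[k∸m]/L*L : ∀ {k m} → m ≤ k → k % L ≡ m % L → k ≡ m + (k ∸ m) / L * L
  %≡%⇒k≡m+[k∸m]/L*L {k} {m} m≤k k≡m = ≡.sym (begin
    m + (k ∸ m) / L * L ≡⟨ ≡.cong (m +_) (m/n*n≡m L∣k∸m) ⟩
    m + (k ∸ m)         ≡⟨ ℕ.m+[n∸m]≡n m≤k ⟩
    k                   ∎)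
    where
      L∣k∸m : L ∣ k ∸ m
      L∣k∸m = divides (k / L ∸ m / L) (begin
        k ∸ m
          ≡⟨ ≡.cong₂ _∸_ (m≡m%n+[m/n]*n k L) (m≡m%n+[m/n]*n m L) ⟩
        (k % L + k / L * L) ∸ (m % L + m / L * L)
          ≡⟨ ≡.cong (λ x → (x + k / L * L) ∸ (m % L + m / L * L)) k≡m ⟩
        (m % L + k / L * L) ∸ (m % L + m / L * L)
          ≡⟨ ℕ.[m+n]∸[m+o]≡n∸o (m % L) (k / L * L) (m / L * L) ⟩
        k / L * L ∸ m / L * L
          ≡⟨ ℕ.*-distribʳ-∸ L (k / L) (m / L) ⟨
        (k / L ∸ m / L) * L
          ∎)

  %≡%⇒m≤k : ∀ {k m} → m ≤ L → 1 ≤ k → k % L ≡ m % L → m ≤ k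
  %≡%⇒m≤k {k} {m} m≤L 1≤k k≡m with m <? L
  ... | yes m<L = ≡.subst (_≤ k) (≡.trans k≡m (m<n⇒m%n≡m m<L)) (m%n≤m k L)
  ... | no  m≮L = ≡.subst (_≤ k) (≡.sym m≡L) (∣⇒≤ {{>-nonZero 1≤k}} (m%n≡0⇒n∣m k L k%L≡0))
    where
      m≡L : m ≡ L
      m≡L = ℕ.≤-antisym m≤L (ℕ.≮⇒≥ m≮L)
      k%L≡0 : k % L ≡ 0
      k%L≡0 = ≡.trans k≡m (≡.trans (≡.cong (_% L) m≡L) (n%n≡0 L))

compress-index : ∀ L .{{_ : NonZero L}} k t → L * (k + t) ∸ (L ∸ 1) * k ≡ k + t * L
compress-index (suc L′) k t =
  ≡.trans (≡.cong (_∸ L′ * k) (expand L′ k t)) (ℕ.m+n∸n≡m (k + t * suc L′) (L′ * k))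
  where
    expand : ∀ L′ k t → suc L′ * (k + t) ≡ k + t * suc L′ + L′ * k
    expand = solve-∀

module PowerSeries {c r : Level} (R : CommutativeRing c r) where
  open CommutativeRing R
    using ( Carrier; _≈_; 0#; refl; reflexive; sym; trans; setoid; +-cong; *-cong
          ; +-assoc; +-comm; +-identityˡ; +-identityʳ; *-assoc; *-comm; *-identityˡ
          ; zeroˡ; zeroʳ; distribˡ; distribʳ; +-commutativeSemigroup )
    renaming (_+_ to _+ᴿ_; _*_ to _*ᴿ_)
  open Series R

  sum-cong : ∀ n {a b : ℕ → Carrier} → (∀ i → i < n → a i ≈ b i) → sumTo n a ≈ sumTo n b
  sum-cong zero    a≈b = refl
  sum-cong (suc n) a≈b = +-cong (sum-cong n λ i i<n → a≈b i (ℕ.m<n⇒m<1+n i<n)) (a≈b n ℕ.≤-refl)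

  sum-zero : ∀ n {a : ℕ → Carrier} → (∀ i → i < n → a i ≈ 0#) → sumTo n a ≈ 0#
  sum-zero zero    a≈0 = refl
  sum-zero (suc n) a≈0 =
    trans (+-cong (sum-zero n λ i i<n → a≈0 i (ℕ.m<n⇒m<1+n i<n)) (a≈0 n ℕ.≤-refl)) (+-identityˡ 0#)

  sum-+ : ∀ n {a b : ℕ → Carrier} → sumTo n (λ i → a i +ᴿ b i) ≈ sumTo n a +ᴿ sumTo n b
  sum-+ zero    = sym (+-identityˡ 0#)
  sum-+ (suc n) = trans (+-cong (sum-+ n) refl) (interchange _ _ _ _)
    where open CommutativeSemigroupProperties +-commutativeSemigroup

  sum-*ˡ : ∀ n x {a : ℕ → Carrier} → x *ᴿ sumTo n a ≈ sumTo n (λ i → x *ᴿ a i)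
  sum-*ˡ zero    x = zeroʳ x
  sum-*ˡ (suc n) x = trans (distribˡ x _ _) (+-cong (sum-*ˡ n x) refl)

  sum-*ʳ : ∀ n x {a : ℕ → Carrier} → sumTo n a *ᴿ x ≈ sumTo n (λ i → a i *ᴿ x)
  sum-*ʳ zero    x = zeroˡ x
  sum-*ʳ (suc n) x = trans (distribʳ x _ _) (+-cong (sum-*ʳ n x) refl)

  sum-head : ∀ n (a : ℕ → Carrier) → sumTo (suc n) a ≈ a 0 +ᴿ sumTo n (λ i → a (suc i))
  sum-head zero    a = +-comm 0# (a 0)
  sum-head (suc n) a = trans (+-cong (sum-head n a) refl) (+-assoc _ _ _)

  sum-reverse : ∀ n (a : ℕ → Carrier) → sumTo (suc n) a ≈ sumTo (suc n) (λ i → a (n ∸ i))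
  sum-reverse zero    a = refl
  sum-reverse (suc n) a = begin
    sumTo (suc n) a +ᴿ a (suc n)                        ≈⟨ +-cong (sum-reverse n a) refl ⟩
    sumTo (suc n) (λ i → a (n ∸ i)) +ᴿ a (suc n)        ≈⟨ +-comm _ _ ⟩
    a (suc n) +ᴿ sumTo (suc n) (λ i → a (n ∸ i))        ≈⟨ sum-head (suc n) (λ i → a (suc n ∸ i)) ⟨
    sumTo (suc (suc n)) (λ i → a (suc n ∸ i))           ∎
    where open SetoidReasoning setoid

  sum-split : ∀ m n (a : ℕ → Carrier) → sumTo (m + n) a ≈ sumTo m a +ᴿ sumTo n (λ i → a (m + i))
  sum-split m zero    a rewrite ℕ.+-identityʳ m = sym (+-identityʳ _)
  sum-split m (suc n) a rewrite ℕ.+-suc m n =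
    trans (+-cong (sum-split m n a) refl) (+-assoc _ _ _)

  sum-triangle : ∀ n (a : ℕ → ℕ → Carrier) →
    sumTo (suc n) (λ i → sumTo (suc i) (λ j → a j i)) ≈
    sumTo (suc n) (λ j → sumTo (suc (n ∸ j)) (λ i → a j (j + i)))
  sum-triangle zero    a = refl
  sum-triangle (suc n) a = begin
    sumTo (suc (suc n)) (λ i → sumTo (suc i) (λ j → a j i))
      ≈⟨ sum-cong (suc (suc n)) (λ i _ → sum-head i (λ j → a j i)) ⟩
    sumTo (suc (suc n)) (λ i → a 0 i +ᴿ sumTo i (λ j → a (suc j) i))
      ≈⟨ sum-+ (suc (suc n)) ⟩
    sumTo (suc (suc n)) (a 0) +ᴿ sumTo (suc (suc n)) (λ i → sumTo i (λ j → a (suc j) i))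
      ≈⟨ +-cong refl (trans (sum-head (suc n) _) (+-identityˡ _)) ⟩
    sumTo (suc (suc n)) (a 0) +ᴿ sumTo (suc n) (λ i → sumTo (suc i) (λ j → a (suc j) (suc i)))
      ≈⟨ +-cong refl (sum-triangle n (λ j i → a (suc j) (suc i))) ⟩
    sumTo (suc (suc n)) (a 0) +ᴿ sumTo (suc n) (λ j → sumTo (suc (n ∸ j)) (λ i → a (suc j) (suc j + i)))
      ≈⟨ sum-head (suc n) _ ⟨
    sumTo (suc (suc n)) (λ j → sumTo (suc (suc n ∸ j)) (λ i → a j (j + i)))
      ∎
    where open SetoidReasoning setoid

  sum-decimate : ∀ L .{{_ : NonZero L}} n (a : ℕ → Carrier) → (∀ i → ¬ (L ∣ i) → a i ≈ 0#) →
    sumTo (suc (n * L)) a ≈ sumTo (suc n) (λ k → a (k * L))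
  sum-decimate (suc L′) zero    a a≈0 = refl
  sum-decimate L@(suc L′) (suc n) a a≈0 = begin
    sumTo (suc (L + n * L)) a                               ≡⟨ ≡.cong (λ k → sumTo k a) (ℕ.+-suc L (n * L)) ⟨
    sumTo (L + suc (n * L)) a                               ≈⟨ sum-split L (suc (n * L)) a ⟩
    sumTo L a +ᴿ sumTo (suc (n * L)) (λ i → a (L + i))      ≈⟨ +-cong first-block (sum-decimate L n _ shifted≈0) ⟩
    a 0 +ᴿ sumTo (suc n) (λ k → a (L + k * L))              ≈⟨ sum-head (suc n) (λ k → a (k * L)) ⟨
    sumTo (suc (suc n)) (λ k → a (k * L))                   ∎
    where
      open SetoidReasoning setoid
      shifted≈0 : ∀ i → ¬ (L ∣ i) → a (L + i) ≈ 0#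
      shifted≈0 i L∤i = a≈0 (L + i) λ L∣L+i → L∤i (∣m+n∣m⇒∣n L∣L+i ∣-refl)
      first-block : sumTo L a ≈ a 0
      first-block = trans (sum-head L′ a) (trans (+-cong refl (sum-zero L′ λ i i<L′ →
        a≈0 (suc i) λ L∣1+i → ℕ.<⇒≱ (s≤s i<L′) (∣⇒≤ L∣1+i))) (+-identityʳ _))

  infix 4 _≋_
  record _≋_ (A B : PS) : Set r where
    constructor pointwise
    field at : ∀ n → A n ≈ B n
  open _≋_ public

  ≋-refl : ∀ {A} → A ≋ A
  ≋-refl = pointwise λ _ → refl

  ≋-sym : ∀ {A B} → A ≋ B → B ≋ A
  ≋-sym A≋B = pointwise λ n → sym (at A≋B n)

  ≋-trans : ∀ {A B C} → A ≋ B → B ≋ C → A ≋ C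
  ≋-trans A≋B B≋C = pointwise λ n → trans (at A≋B n) (at B≋C n)

  ≋-reflexive : ∀ {A B} → A ≡ B → A ≋ B
  ≋-reflexive ≡.refl = ≋-refl

  ≋-isEquivalence : IsEquivalence _≋_
  ≋-isEquivalence = record { refl = ≋-refl ; sym = ≋-sym ; trans = ≋-trans }

  ⊛-cong : ∀ {A A′ B B′} → A ≋ A′ → B ≋ B′ → A ⊛ B ≋ A′ ⊛ B′
  ⊛-cong A≋A′ B≋B′ = pointwise λ n → sum-cong (suc n) λ i _ → *-cong (at A≋A′ i) (at B≋B′ (n ∸ i))

  ⊛-comm : ∀ A B → A ⊛ B ≋ B ⊛ A
  ⊛-comm A B = pointwise λ n → trans (sum-reverse n _) (sum-cong (suc n) λ i i≤n →
    trans (*-cong refl (reflexive (≡.cong B (ℕ.m∸[m∸n]≡n (ℕ.≤-pred i≤n))))) (*-comm _ _))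

  ⊛-assoc : ∀ A B C → (A ⊛ B) ⊛ C ≋ A ⊛ (B ⊛ C)
  ⊛-assoc A B C = pointwise λ n → begin
    sumTo (suc n) (λ i → sumTo (suc i) (λ j → A j *ᴿ B (i ∸ j)) *ᴿ C (n ∸ i))
      ≈⟨ sum-cong (suc n) (λ i _ → sum-*ʳ (suc i) (C (n ∸ i))) ⟩
    sumTo (suc n) (λ i → sumTo (suc i) (λ j → (A j *ᴿ B (i ∸ j)) *ᴿ C (n ∸ i)))
      ≈⟨ sum-triangle n (λ j i → (A j *ᴿ B (i ∸ j)) *ᴿ C (n ∸ i)) ⟩
    sumTo (suc n) (λ j → sumTo (suc (n ∸ j)) (λ i → (A j *ᴿ B (j + i ∸ j)) *ᴿ C (n ∸ (j + i))))
      ≈⟨ sum-cong (suc n) (λ j _ → sum-cong (suc (n ∸ j)) λ i _ → trans (*-assoc _ _ _)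
           (*-cong refl (*-cong (reflexive (≡.cong B (ℕ.m+n∸m≡n j i)))
                                (reflexive (≡.cong C (≡.sym (ℕ.∸-+-assoc n j i))))))) ⟩
    sumTo (suc n) (λ j → sumTo (suc (n ∸ j)) (λ i → A j *ᴿ (B i *ᴿ C (n ∸ j ∸ i))))
      ≈⟨ sum-cong (suc n) (λ j _ → sum-*ˡ (suc (n ∸ j)) (A j)) ⟨
    sumTo (suc n) (λ j → A j *ᴿ sumTo (suc (n ∸ j)) (λ i → B i *ᴿ C (n ∸ j ∸ i)))
      ∎
    where open SetoidReasoning setoid

  one-⊛ : ∀ A → one ⊛ A ≋ A
  one-⊛ A = pointwise λ n → trans (sum-head n _)
    (trans (+-cong (*-identityˡ (A n)) (sum-zero n λ i _ → zeroˡ _)) (+-identityʳ _))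

  ⊛-one : ∀ A → A ⊛ one ≋ A
  ⊛-one A = ≋-trans (⊛-comm A one) (one-⊛ A)

  ⊛-commutativeMonoid : CommutativeMonoid c r
  ⊛-commutativeMonoid = record
    { isCommutativeMonoid = record
      { isMonoid = record
        { isSemigroup = record
          { isMagma = record { isEquivalence = ≋-isEquivalence ; ∙-cong = ⊛-cong }
          ; assoc = ⊛-assoc }
        ; identity = one-⊛ , ⊛-one }
      ; comm = ⊛-comm } }

  ≋-setoid : Setoid c r
  ≋-setoid = CommutativeMonoid.setoid ⊛-commutativeMonoid

  open CommutativeSemigroupProperties (CommutativeMonoid.commutativeSemigroup ⊛-commutativeMonoid)
    using () renaming (interchange to ⊛-interchange)

  ^-cong : ∀ {A B} q → A ≋ B → A ^ₚ q ≋ B ^ₚ q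
  ^-cong zero    A≋B = ≋-refl
  ^-cong (suc q) A≋B = ⊛-cong (^-cong q A≋B) A≋B

  one-^ : ∀ q → one ^ₚ q ≋ one
  one-^ zero    = ≋-refl
  one-^ (suc q) = ≋-trans (⊛-one _) (one-^ q)

  ^-distrib-⊛ : ∀ A B q → (A ⊛ B) ^ₚ q ≋ (A ^ₚ q) ⊛ (B ^ₚ q)
  ^-distrib-⊛ A B zero    = ≋-sym (one-⊛ one)
  ^-distrib-⊛ A B (suc q) =
    ≋-trans (⊛-cong (^-distrib-⊛ A B q) (≋-refl {A ⊛ B})) (⊛-interchange (A ^ₚ q) (B ^ₚ q) A B)

  prodFin-cong : ∀ m {F G : Fin m → PS} → (∀ j → F j ≋ G j) → prodFin m F ≋ prodFin m G
  prodFin-cong zero    F≋G = ≋-refl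
  prodFin-cong (suc m) F≋G = ⊛-cong (F≋G Fin.zero) (prodFin-cong m (F≋G ∘ Fin.suc))

  prodFin-^ : ∀ m (F : Fin m → PS) q → prodFin m (λ j → F j ^ₚ q) ≋ prodFin m F ^ₚ q
  prodFin-^ zero    F q = ≋-sym (one-^ q)
  prodFin-^ (suc m) F q =
    ≋-trans (⊛-cong ≋-refl (prodFin-^ m (F ∘ Fin.suc) q)) (≋-sym (^-distrib-⊛ _ _ q))

  prodFirst-zero : ∀ m (F : Fin m → PS) → prodFirst m F 0 ≡ one
  prodFirst-zero zero    F = ≡.refl
  prodFirst-zero (suc m) F = ≡.refl

  prodFirst-all : ∀ m (F : Fin m → PS) → prodFirst m F m ≡ prodFin m F
  prodFirst-all zero    F = ≡.refl
  prodFirst-all (suc m) F = ≡.cong (F Fin.zero ⊛_) (prodFirst-all m (F ∘ Fin.suc))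

  prodFin-^-split : ∀ m (h : Fin m → PS) m′ q →
    prodFin m (λ j → h j ^ₚ ([ toℕ j < m′ ] + q)) ≋ prodFirst m h m′ ⊛ (prodFin m h ^ₚ q)
  prodFin-^-split zero    h m′       q = ≋-sym (≋-trans (one-⊛ _) (one-^ q))
  prodFin-^-split (suc m) h zero     q = ≋-trans (prodFin-^ (suc m) h q) (≋-sym (one-⊛ _))
  prodFin-^-split (suc m) h (suc m′) q = begin
    ((h₀ ^ₚ q) ⊛ h₀) ⊛ prodFin m (λ j → h (Fin.suc j) ^ₚ ([ toℕ j < m′ ] + q))
      ≈⟨ ⊛-cong (⊛-comm (h₀ ^ₚ q) h₀) (prodFin-^-split m (h ∘ Fin.suc) m′ q) ⟩
    (h₀ ⊛ (h₀ ^ₚ q)) ⊛ (first ⊛ (rest ^ₚ q))    ≈⟨ ⊛-interchange h₀ (h₀ ^ₚ q) first (rest ^ₚ q) ⟩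
    (h₀ ⊛ first) ⊛ ((h₀ ^ₚ q) ⊛ (rest ^ₚ q))    ≈⟨ ⊛-cong (≋-refl {h₀ ⊛ first}) (^-distrib-⊛ h₀ rest q) ⟨
    (h₀ ⊛ first) ⊛ ((h₀ ⊛ rest) ^ₚ q)           ∎
    where
      open SetoidReasoning ≋-setoid
      h₀ = h Fin.zero
      first = prodFirst m (h ∘ Fin.suc) m′
      rest = prodFin m (h ∘ Fin.suc)

  shift : ℕ → PS → PS
  shift zero    A = A
  shift (suc s) A = tmul (shift s A)

  shift-cong : ∀ s {A B} → A ≋ B → shift s A ≋ shift s B
  shift-cong zero    A≋B = A≋B
  shift-cong (suc s) A≋B = pointwise λ where
    zero    → refl
    (suc n) → at (shift-cong s A≋B) n

  shift-at : ∀ s A n → shift s A (s + n) ≡ A n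
  shift-at zero    A n = ≡.refl
  shift-at (suc s) A n = shift-at s A n

  shift-+ : ∀ s t A → shift s (shift t A) ≡ shift (s + t) A
  shift-+ zero    t A = ≡.refl
  shift-+ (suc s) t A = ≡.cong tmul (shift-+ s t A)

  tmul-⊛ : ∀ A B → tmul A ⊛ B ≋ tmul (A ⊛ B)
  tmul-⊛ A B = pointwise λ where
    zero    → trans (+-identityˡ _) (zeroˡ _)
    (suc n) → trans (sum-head (suc n) _) (trans (+-cong (zeroˡ _) refl) (+-identityˡ _))

  shift-⊛ˡ : ∀ s A B → shift s A ⊛ B ≋ shift s (A ⊛ B)
  shift-⊛ˡ zero    A B = ≋-refl
  shift-⊛ˡ (suc s) A B = ≋-trans (tmul-⊛ (shift s A) B) (shift-cong 1 (shift-⊛ˡ s A B))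

  shift-⊛ʳ : ∀ s A B → A ⊛ shift s B ≋ shift s (A ⊛ B)
  shift-⊛ʳ s A B = ≋-trans (⊛-comm A _) (≋-trans (shift-⊛ˡ s B A) (shift-cong s (⊛-comm B A)))

  shift-⊛ : ∀ s t A B → shift s A ⊛ shift t B ≋ shift (s + t) (A ⊛ B)
  shift-⊛ s t A B = ≋-trans (shift-⊛ˡ s A (shift t B))
    (≋-trans (shift-cong s (shift-⊛ʳ t A B)) (≋-reflexive (shift-+ s t (A ⊛ B))))

  shift-^ : ∀ s A q → shift s A ^ₚ q ≋ shift (q * s) (A ^ₚ q)
  shift-^ s A zero    = ≋-refl
  shift-^ s A (suc q) = ≋-trans (⊛-cong (shift-^ s A q) (≋-refl {shift s A}))
    (≋-trans (shift-⊛ (q * s) s (A ^ₚ q) A)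
             (≋-reflexive (≡.cong (λ i → shift i (A ^ₚ suc q)) (ℕ.+-comm (q * s) s))))

  prodFirst-shift : ∀ m {h H : Fin m → PS} m′ → m′ ≤ m → (∀ j → h j ≋ tmul (H j)) →
    prodFirst m h m′ ≋ shift m′ (prodFirst m H m′)
  prodFirst-shift zero    zero     z≤n        h≋tH = ≋-refl
  prodFirst-shift (suc m) zero     z≤n        h≋tH = ≋-refl
  prodFirst-shift (suc m) (suc m′) (s≤s m′≤m) h≋tH =
    ≋-trans (⊛-cong (h≋tH Fin.zero) (prodFirst-shift m m′ m′≤m (h≋tH ∘ Fin.suc)))
            (shift-⊛ 1 m′ _ _)

  prodFin-shift : ∀ m {h H : Fin m → PS} → (∀ j → h j ≋ tmul (H j)) →
    prodFin m h ≋ shift m (prodFin m H)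
  prodFin-shift m {h} {H} h≋tH =
    ≡.subst₂ (λ P Q → P ≋ shift m Q) (prodFirst-all m h) (prodFirst-all m H)
      (prodFirst-shift m m ℕ.≤-refl h≋tH)

module Dilations {c r : Level} (R : CommutativeRing c r) (L : ℕ) .{{_ : NonZero L}} where
  open CommutativeRing R
    using (Carrier; _≈_; 0#; refl; reflexive; sym; trans; setoid; *-cong; zeroˡ; zeroʳ)
    renaming (_*_ to _*ᴿ_)
  open Series R
  open PowerSeries R

  -- A(t) = a(t^L)
  record Dilation (A a : PS) : Set r where
    field
      vanishes-off : ∀ N → ¬ (L ∣ N) → A N ≈ 0#
      at-multiple  : ∀ k → A (k * L) ≈ a k
  open Dilation

  Dilation-hatEven : ∀ {A} → InPowT^ L A → Dilation A (hatEven L A)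
  Dilation-hatEven {A} A∈K[[tᴸ]] = record
    { vanishes-off = A∈K[[tᴸ]]
    ; at-multiple  = λ k → reflexive (≡.cong A (ℕ.*-comm k L)) }

  Dilation-one : Dilation one one
  Dilation-one = record
    { vanishes-off = λ where
        zero    L∤0 → ⊥-elim (L∤0 (L ∣0))
        (suc N) _   → refl
    ; at-multiple  = λ where
        zero    → refl
        (suc k) → one-positive (L + k * L) (ℕ.<-≤-trans (>-nonZero⁻¹ L) (ℕ.m≤m+n L (k * L))) }
    where
      one-positive : ∀ N → 0 < N → one N ≈ 0#
      one-positive (suc N) _ = refl

  Dilation-⊛ : ∀ {A B a b} → Dilation A a → Dilation B b → Dilation (A ⊛ B) (a ⊛ b)
  Dilation-⊛ {A} {B} {a} {b} A≈a B≈b = record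
    { vanishes-off = λ N L∤N → sum-zero (suc N) λ i i≤N → term-vanishes N L∤N i (ℕ.≤-pred i≤N)
    ; at-multiple  = λ k → begin
        sumTo (suc (k * L)) (λ i → A i *ᴿ B (k * L ∸ i))
          ≈⟨ sum-decimate L k _ (λ i L∤i → trans (*-cong (vanishes-off A≈a i L∤i) refl) (zeroˡ _)) ⟩
        sumTo (suc k) (λ j → A (j * L) *ᴿ B (k * L ∸ j * L))
          ≈⟨ sum-cong (suc k) (λ j _ → *-cong (at-multiple A≈a j)
               (trans (reflexive (≡.cong B (≡.sym (ℕ.*-distribʳ-∸ L k j)))) (at-multiple B≈b (k ∸ j)))) ⟩
        sumTo (suc k) (λ j → a j *ᴿ b (k ∸ j))
          ∎ }
    where
      open SetoidReasoning setoid
      term-vanishes : ∀ N → ¬ (L ∣ N) → ∀ i → i ≤ N → A i *ᴿ B (N ∸ i) ≈ 0#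
      term-vanishes N L∤N i i≤N with L ∣? i
      ... | no  L∤i = trans (*-cong (vanishes-off A≈a i L∤i) refl) (zeroˡ _)
      ... | yes L∣i = trans (*-cong refl (vanishes-off B≈b (N ∸ i) λ L∣N∸i →
                        L∤N (≡.subst (L ∣_) (ℕ.m+[n∸m]≡n i≤N) (∣m∣n⇒∣m+n L∣i L∣N∸i)))) (zeroʳ _)

  Dilation-^ : ∀ {A a} → Dilation A a → ∀ q → Dilation (A ^ₚ q) (a ^ₚ q)
  Dilation-^ A≈a zero    = Dilation-one
  Dilation-^ A≈a (suc q) = Dilation-⊛ (Dilation-^ A≈a q) A≈a

  Dilation-prodFin : ∀ m {H h : Fin m → PS} → (∀ j → Dilation (H j) (h j)) →
    Dilation (prodFin m H) (prodFin m h)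
  Dilation-prodFin zero    H≈h = Dilation-one
  Dilation-prodFin (suc m) H≈h = Dilation-⊛ (H≈h Fin.zero) (Dilation-prodFin m (H≈h ∘ Fin.suc))

  Dilation-prodFirst : ∀ m {H h : Fin m → PS} m′ → (∀ j → Dilation (H j) (h j)) →
    Dilation (prodFirst m H m′) (prodFirst m h m′)
  Dilation-prodFirst zero    m′       H≈h = Dilation-one
  Dilation-prodFirst (suc m) zero     H≈h = Dilation-one
  Dilation-prodFirst (suc m) (suc m′) H≈h =
    Dilation-⊛ (H≈h Fin.zero) (Dilation-prodFirst m m′ (H≈h ∘ Fin.suc))

module Compression {c r : Level} (R : CommutativeRing c r) (L : ℕ) .{{_ : NonZero L}} where
  open CommutativeRing R using (_≈_; refl; reflexive; setoid)
  open Series R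
  open PowerSeries R
  open Dilations R L

  column : PS → (Fin L → PS) → ℕ → ℕ → PS
  column G h m q = G ⊛ (prodFirst L h m ⊛ (prodFin L h ^ₚ q))

  column-zero : ∀ G h q → column G h 0 q ≋ G ⊛ (prodFin L h ^ₚ q)
  column-zero G h q = ⊛-cong (≋-refl {G})
    (≋-trans (⊛-cong (≋-reflexive (prodFirst-zero L h)) (≋-refl {prodFin L h ^ₚ q})) (one-⊛ (prodFin L h ^ₚ q)))

  mar-column : ∀ b g f {m} q → m < L → ∀ N → mar L b g f N (suc (m + q * L)) ≈ tmul (column g f m q) N
  mar-column b g f {m} q m<L = at (shift-cong 1 (⊛-cong (≋-refl {g})
    (≋-trans (prodFin-cong L λ j → ≋-reflexive (≡.cong (f j ^ₚ_) (exponent j))) (prodFin-^-split L f m q))))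
    where
      exponent : ∀ j → expo L j (suc (m + q * L)) ≡ [ toℕ j < m ] + q
      exponent j = [m+qL+L∸1+j]/L≡[j<m]+q L q (toℕ<n j) m<L

  column-shift : ∀ G {h H : Fin L → PS} m q → m ≤ L → (∀ j → h j ≋ tmul (H j)) →
    column G h m q ≋ shift (m + q * L) (column G H m q)
  column-shift G {h} {H} m q m≤L h≋tH = begin
    G ⊛ (prodFirst L h m ⊛ (prodFin L h ^ₚ q))
      ≈⟨ ⊛-cong (≋-refl {G}) (⊛-cong (prodFirst-shift L m m≤L h≋tH) (^-cong q (prodFin-shift L h≋tH))) ⟩
    G ⊛ (shift m F ⊛ (shift L P ^ₚ q))
      ≈⟨ ⊛-cong (≋-refl {G}) (⊛-cong (≋-refl {shift m F}) (shift-^ L P q)) ⟩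
    G ⊛ (shift m F ⊛ shift (q * L) (P ^ₚ q))
      ≈⟨ ⊛-cong (≋-refl {G}) (shift-⊛ m (q * L) F (P ^ₚ q)) ⟩
    G ⊛ shift (m + q * L) (F ⊛ (P ^ₚ q))
      ≈⟨ shift-⊛ʳ (m + q * L) G (F ⊛ (P ^ₚ q)) ⟩
    shift (m + q * L) (column G H m q)
      ∎
    where
      open SetoidReasoning ≋-setoid
      F = prodFirst L H m
      P = prodFin L H

  Dilation-column : ∀ {G g} {H h : Fin L → PS} m q → Dilation G g → (∀ j → Dilation (H j) (h j)) →
    Dilation (column G H m q) (column g h m q)
  Dilation-column m q G≈g H≈h =
    Dilation-⊛ G≈g (Dilation-⊛ (Dilation-prodFirst L m H≈h) (Dilation-^ (Dilation-prodFin L H≈h) q))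

  tdiv : PS → PS
  tdiv A n = A (suc n)

  InTPowT^⇒≋tmul-tdiv : ∀ {A} → InTPowT^ L A → A ≋ tmul (tdiv A)
  InTPowT^⇒≋tmul-tdiv (A₀≈0 , _) = pointwise λ where
    zero    → A₀≈0
    (suc n) → refl

  hatOdd≋tmul-hatEven-tdiv : ∀ A → hatOdd L A ≋ tmul (hatEven L (tdiv A))
  hatOdd≋tmul-hatEven-tdiv A = pointwise λ where
    zero    → refl
    (suc k) → reflexive (≡.cong A (ℕ.+-comm (L * k) 1))

  compress-column : ∀ b g f → InPowT^ L g → (∀ j → InTPowT^ L (f j)) →
    ∀ {n k m} q → m < L → k ≡ suc (m + q * L) → k ≤ n →
    compress L (mar L b g f) n k ≈ tmul (column (hatEven L g) (λ j → hatOdd L (f j)) m q) n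
  compress-column b g f g∈ f∈ {n} {k} {m} q m<L ≡.refl k≤n = begin
    mar L b g f (L * n ∸ (L ∸ 1) * k) k       ≡⟨ ≡.cong (λ N → mar L b g f N k) N≡k+tL ⟩
    mar L b g f (k + t * L) k                 ≈⟨ mar-column b g f q m<L (k + t * L) ⟩
    tmul (column g f m q) (k + t * L)         ≈⟨ at (shift-cong 1 (column-shift g m q m≤L f≋tF)) (k + t * L) ⟩
    shift k (column g F m q) (k + t * L)      ≡⟨ shift-at k (column g F m q) (t * L) ⟩
    column g F m q (t * L)                    ≈⟨ at-multiple (Dilation-column m q g≈ĝ F≈φ) t ⟩
    column ĝ φ m q t                          ≡⟨ shift-at k (column ĝ φ m q) t ⟨
    shift k (column ĝ φ m q) (k + t)          ≈⟨ at (shift-cong 1 (column-shift ĝ m q m≤L f̂≋tφ)) (k + t) ⟨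
    tmul (column ĝ f̂ m q) (k + t)             ≡⟨ ≡.cong (tmul (column ĝ f̂ m q)) (ℕ.m+[n∸m]≡n k≤n) ⟩
    tmul (column ĝ f̂ m q) n                   ∎
    where
      open SetoidReasoning setoid
      open Dilation
      t = n ∸ k
      m≤L = ℕ.<⇒≤ m<L
      ĝ = hatEven L g
      F = λ j → tdiv (f j)
      φ = λ j → hatEven L (F j)
      f̂ = λ j → hatOdd L (f j)
      N≡k+tL : L * n ∸ (L ∸ 1) * k ≡ k + t * L
      N≡k+tL = ≡.trans (≡.cong (λ n → L * n ∸ (L ∸ 1) * k) (≡.sym (ℕ.m+[n∸m]≡n k≤n))) (compress-index L k t)
      f≋tF : ∀ j → f j ≋ tmul (F j)
      f≋tF j = InTPowT^⇒≋tmul-tdiv (f∈ j)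
      f̂≋tφ : ∀ j → f̂ j ≋ tmul (φ j)
      f̂≋tφ j = hatOdd≋tmul-hatEven-tdiv (f j)
      g≈ĝ : Dilation g ĝ
      g≈ĝ = Dilation-hatEven g∈
      F≈φ : ∀ j → Dilation (F j) (φ j)
      F≈φ j = Dilation-hatEven (proj₂ (f∈ j))

theorem5p1 : {c r : Level} (R : CommutativeRing c r)
    → let open CommutativeRing R
          open Series R
      in IsField → CharZero
    → (L : ℕ) → (2≤L : 2 ≤ L)
    → let instance
            nzL = ≥2⇒nonZero 2≤L
      in (b g : PS) → (f : Fin L → PS)
    → InPowT^ L b → InPowT^ L g → (∀ j → InTPowT^ L (f j))
    → ¬ (b 0 ≈ 0#) → ¬ (g 0 ≈ 0#) → (∀ j → ¬ (f j 1 ≈ 0#))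
    → let d  = compress L (mar L b g f)
          bh = hatEven L b
          gh = hatEven L g
          fh = λ j → hatOdd L (f j)
          P  = prodFin L fh
      in ((n : ℕ) → d n 0 ≈ bh n)
       × ((n k : ℕ) → 1 ≤ k → k ≤ n → k % L ≡ 1
           → d n k ≈ tmul (gh ⊛ (P ^ₚ ((k ∸ 1) / L))) n)
       × ((n k m : ℕ) → 1 ≤ k → k ≤ n → 2 ≤ m → m ≤ L → k % L ≡ m % L
           → d n k ≈ tmul (gh ⊛ (prodFirst L fh (m ∸ 1) ⊛ (P ^ₚ ((k ∸ m) / L)))) n)
theorem5p1 R _ _ L 2≤L b g f _ g∈ f∈ _ _ _ =
    (λ n → reflexive (≡.cong (λ x → b (L * n ∸ x)) (ℕ.*-zeroʳ (L ∸ 1))))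
  , (λ n k 1≤k k≤n k≡1 →
      trans (compress-column b g f g∈ f∈ ((k ∸ 1) / L) (>-nonZero⁻¹ L)
                             (%≡%⇒k≡m+[k∸m]/L*L L 1≤k (≡.trans k≡1 (≡.sym (m<n⇒m%n≡m 2≤L)))) k≤n)
            (at (shift-cong 1 (column-zero (hatEven L g) (λ j → hatOdd L (f j)) ((k ∸ 1) / L))) n))
  , λ where
      n k (suc m) 1≤k k≤n (s≤s _) 1+m≤L k≡m →
        compress-column b g f g∈ f∈ ((k ∸ suc m) / L) 1+m≤L
                        (%≡%⇒k≡m+[k∸m]/L*L L (%≡%⇒m≤k L 1+m≤L 1≤k k≡m) k≡m) k≤n
  where
    open CommutativeRing R using (reflexive; trans)
    open Series R
    open PowerSeries R
    instance
      _ : NonZero L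
      _ = ≥2⇒nonZero 2≤L
    open Compression R L
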